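{- Consider states with Boolean variables $\mathsf{flag}_0,\mathsf{flag}_1,\mathsf{turn},\mathsf{turn\_aux}_0,\mathsf{turn\_aux}_1$ and variables $\mathsf{shared},\mathsf{local}_0,\mathsf{local}_1$ of some type $T$; let $P_0,Q_0,P_1,Q_1$ be predicates on $T$, $\rho$ a code retrieving function (all triples and correspondences below are w.r.t. $\rho$), and $cs_0,cs_1$ terms. Assume (1) $\models\{\mathsf{shared}=\mathsf{shared}'\wedge\mathsf{local}_0=\mathsf{local}_0',\ P_0\,\mathsf{shared}\}\,cs_0\,\{Q_0\,\mathsf{shared},\ G_0\}$, (2) $\models\{\mathsf{shared}=\mathsf{shared}'\wedge\mathsf{local}_1=\mathsf{local}_1',\ P_1\,\mathsf{shared}\}\,cs_1\,\{Q_1\,\mathsf{shared},\ G_1\}$, (3) $\rho,\rho\models cs_0\sqsupseteq_{r_0}cs_0$, (4) $\rho,\rho\models cs_1\sqsupseteq_{r_1}cs_1$, (5) $\rho,\rho\models cs_0\sqsupseteq_{r_{eqv}}cs_0$, (6) $\rho,\rho\models cs_1\sqsupseteq_{r_{eqv}}cs_1$. Then $\models\{\mathrm{id},\ P_0\,\mathsf{shared}\wedge P_1\,\mathsf{shared}\}\ \mathrm{thread}_0\,cs_0\parallel\mathrm{thread}_1\,cs_1\ \{Q_0\,\mathsf{shared}\wedge Q_1\,\mathsf{shared},\ \top\}$.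
   Context: Program terms over a state type $\alpha$ are generated by $p::=\mathbf{skip}\mid\mathbf{basic}\,f\mid\mathbf{cjump}\,C\,i\,p\mid\mathbf{while}\,C\,p\,p\mid\mathbf{if}\,C\,p\,p\mid p;p\mid\Vert(p_1,\dots,p_m)\mid\mathbf{await}\,C\,p$ ($f:\alpha\to\alpha$, $C\subseteq\alpha$, $i\in\mathbb N$, $m\ge1$; $p\parallel q=\Vert(p,q)$; $p_1;p_2;p_3=p_1;(p_2;p_3)$). A code retrieving function $\rho$ maps $\mathbb N$ to terms. The program step relation $\rho\vdash(p,\sigma)\to_{\mathcal P}(p',\sigma')$ is the least relation with: $(\mathbf{basic}\,f,\sigma)\to(\mathbf{skip},f\sigma)$; $(\mathbf{cjump}\,C\,i\,p,\sigma)\to(\rho\,i,\sigma)$ if $\sigma\in C$, $\to(p,\sigma)$ otherwise; $(\mathbf{await}\,C\,p,\sigma)\to(\mathbf{skip},\sigma')$ if $\sigma\in C$ and $(p,\sigma)\to^*(\mathbf{skip},\sigma')$; $(\mathbf{if}\,C\,p_1\,p_2,\sigma)\to(p_1,\sigma)$ if $\sigma\in C$, $\to(p_2,\sigma)$ otherwise; for $x=\mathbf{while}\,C\,p_1\,p_2$: $(x,\sigma)\to(p_1;(\mathbf{skip};x),\sigma)$ if $\sigma\in C$, $\to(p_2,\sigma)$ otherwise; $(p_1;p_2,\sigma)\to(p_1';p_2,\sigma')$ if $(p_1,\sigma)\to(p_1',\sigma')$; $(\mathbf{skip};p,\sigma)\to(p,\sigma)$; $(\Vert(\dots,p_i,\dots),\sigma)\to(\Vert(\dots,p_i',\dots),\sigma')$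 if $(p_i,\sigma)\to(p_i',\sigma')$; $(\Vert(\mathbf{skip},\dots,\mathbf{skip}),\sigma)\to(\mathbf{skip},\sigma)$. A finite potential computation of $(\rho,p)$ is a nonempty finite sequence $(p_0,\sigma_0),\dots,(p_{n-1},\sigma_{n-1})$ with $p_0=p$ where each transition is a program step or an environment step ($p_{i+1}=p_i$, state arbitrary). For state relations $R,G$ and state predicates $P,Q$, $\models\{R,P\}\,p\,\{Q,G\}$ means: every such computation with $\sigma_0\in P$ and $(\sigma_i,\sigma_{i+1})\in R$ for all environment steps has $(\sigma_i,\sigma_{i+1})\in G$ for all program steps and, if some $p_i=\mathbf{skip}$, $\sigma_i\in Q$ for the least such $i$. A relation $X$ between terms is a simulation w.r.t. $\rho,\rho,r$ ($r$ a state relation) if (i) whenever $(p,q)\in X$, $(\sigma_1,\sigma_2)\in r$, $\rho\vdash(q,\sigma_2)\to_{\mathcal P}(q',\sigma_2')$, there is $\rho\vdash(p,\sigma_1)\to_{\mathcal P}(p',\sigma_1')$ with $(p',q')\in X$, $(\sigma_1',\sigma_2')\in r$; (ii) $(\mathbf{skip},q)\in X\Rightarrow q=\mathbf{skip}$; (iii) $(p,\mathbf{skip})\in X\Rightarrow p=\mathbf{skip}$; $\rho,\rho\models p\sqsupseteq_r q$ means some such simulation contains $(p,q)$. States are assignments of values to the listed variables; $v:=t$ abbreviates $\mathbf{basic}(\lambda\sigma.\,\sigma[v:=t])$ where variables in $t$ are evaluated in $\sigma$. A Boolean expression over variables denotes the set of states satisfying it; an expression over unprimed and primed variables denotes the state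 relation $\{(\sigma,\sigma')\mid\dots\}$ with unprimed variables evaluated in $\sigma$ and primed in $\sigma'$; $\mathrm{id}$ is the identity relation and $\top$ the full relation. $\mathbf{while}\,C\,p$ abbreviates $\mathbf{while}\,C\,p\,\mathbf{skip}$. Define $\mathrm{thread}_0\,cs_0=\mathsf{flag}_0:=\mathrm{True};\ \mathsf{turn}:=\mathrm{True};\ \mathbf{while}\,(\mathsf{flag}_1\wedge\mathsf{turn})\,\mathbf{skip};\ cs_0;\ \mathsf{flag}_0:=\mathrm{False}$, $\mathrm{thread}_1\,cs_1=\mathsf{flag}_1:=\mathrm{True};\ \mathsf{turn}:=\mathrm{False};\ \mathbf{while}\,(\mathsf{flag}_0\wedge\neg\mathsf{turn})\,\mathbf{skip};\ cs_1;\ \mathsf{flag}_1:=\mathrm{False}$. Let $\mathsf{cond}_0=\mathsf{flag}_0\wedge(\neg\mathsf{turn\_aux}_1\vee\neg\mathsf{flag}_1\vee\neg\mathsf{turn})$, $\mathsf{cond}_1=\mathsf{flag}_1\wedge(\neg\mathsf{turn\_aux}_0\vee\neg\mathsf{flag}_0\vee\mathsf{turn})$, $r_0=\{(\sigma,\sigma)\mid\sigma(\mathsf{turn\_aux}_0)\wedge\sigma\in\mathsf{cond}_0\}$, $r_1=\{(\sigma,\sigma)\mid\sigma(\mathsf{turn\_aux}_1)\wedge\sigma\in\mathsf{cond}_1\}$, and $r_{eqv}$ the relation of states agreeing on $\mathsf{flag}_0,\mathsf{flag}_1,\mathsf{turn},\mathsf{shared},\mathsf{local}_0,\mathsf{local}_1$.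 $G_0$ is the relation $\mathsf{flag}_0=\mathsf{flag}_0'\wedge\mathsf{flag}_1=\mathsf{flag}_1'\wedge\mathsf{turn}=\mathsf{turn}'\wedge\mathsf{local}_1=\mathsf{local}_1'\wedge\mathsf{turn\_aux}_0=\mathsf{turn\_aux}_0'\wedge\mathsf{turn\_aux}_1=\mathsf{turn\_aux}_1'\wedge(P_1\,\mathsf{shared}\to P_1\,\mathsf{shared}')\wedge(Q_1\,\mathsf{shared}\to Q_1\,\mathsf{shared}')$, and $G_1$ is the same with $\mathsf{local}_0$ in place of $\mathsf{local}_1$ and $P_0,Q_0$ in place of $P_1,Q_1$. -}

module Defs where

open import Data.Nat using (ℕ; zero; suc; _<_)
open import Data.Fin using (Fin)
open import Data.Vec using (Vec; []; _∷_; lookup; _[_]≔_)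
open import Data.Vec.Relation.Unary.All using (All)
open import Data.Bool using (Bool; true; false; _∧_; _∨_; not; T)
open import Data.Product using (_×_; _,_; proj₁; proj₂; ∃)
open import Data.Sum using (_⊎_)
open import Data.Unit using (⊤)
open import Relation.Binary.PropositionalEquality using (_≡_; _≢_)
open import Relation.Nullary using (¬_)

-- Program terms over a state type α.  A set of states C ⊆ α is a
-- predicate α → Set.  Parallel composition ‖(p₁,…,pₘ), m ≥ 1, is
-- `par m ps` with ps a vector of length suc m.

data Term (α : Set) : Set₁ where
  skip  : Term α
  basic : (α → α) → Term α
  cjump : (α → Set) → ℕ → Term α → Term α
  while : (α → Set) → Term α → Term α → Term α
  if    : (α → Set) → Term α → Term α → Term α
  _⨾_   : Term α → Term α → Term α
  par   : (m : ℕ) → Vec (Term α) (suc m) → Term α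
  await : (α → Set) → Term α → Term α

infixr 5 _⨾_

_∥_ : {α : Set} → Term α → Term α → Term α
p ∥ q = par 1 (p ∷ q ∷ [])

Config : Set → Set₁
Config α = Term α × α

CodeRet : Set → Set₁
CodeRet α = ℕ → Term α

mutual
  data Step {α : Set} (ρ : CodeRet α) : Config α → Config α → Set₁ where
    basic-step  : ∀ f σ → Step ρ (basic f , σ) (skip , f σ)
    cjump-yes   : ∀ {C i p σ} → C σ → Step ρ (cjump C i p , σ) (ρ i , σ)
    cjump-no    : ∀ {C i p σ} → ¬ C σ → Step ρ (cjump C i p , σ) (p , σ)
    await-step  : ∀ {C p σ σ'} → C σ → Steps ρ (p , σ) (skip , σ') →
                  Step ρ (await C p , σ) (skip , σ')
    if-yes      : ∀ {C p₁ p₂ σ} → C σ → Step ρ (if C p₁ p₂ , σ) (p₁ , σ)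
    if-no       : ∀ {C p₁ p₂ σ} → ¬ C σ → Step ρ (if C p₁ p₂ , σ) (p₂ , σ)
    while-yes   : ∀ {C p₁ p₂ σ} → C σ →
                  Step ρ (while C p₁ p₂ , σ) (p₁ ⨾ (skip ⨾ while C p₁ p₂) , σ)
    while-no    : ∀ {C p₁ p₂ σ} → ¬ C σ → Step ρ (while C p₁ p₂ , σ) (p₂ , σ)
    seq-step    : ∀ {p₁ p₁' p₂ σ σ'} → Step ρ (p₁ , σ) (p₁' , σ') →
                  Step ρ (p₁ ⨾ p₂ , σ) (p₁' ⨾ p₂ , σ')
    seq-skip    : ∀ {p σ} → Step ρ (skip ⨾ p , σ) (p , σ)
    par-step    : ∀ {m} {ps : Vec (Term α) (suc m)} (i : Fin (suc m)) {p' σ σ'} →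
                  Step ρ (lookup ps i , σ) (p' , σ') →
                  Step ρ (par m ps , σ) (par m (ps [ i ]≔ p') , σ')
    par-skip    : ∀ {m} {ps : Vec (Term α) (suc m)} {σ} → All (_≡ skip) ps →
                  Step ρ (par m ps , σ) (skip , σ)

  data Steps {α : Set} (ρ : CodeRet α) : Config α → Config α → Set₁ where
    done : ∀ {c} → Steps ρ c c
    more : ∀ {c₁ c₂ c₃} → Step ρ c₁ c₂ → Steps ρ c₂ c₃ → Steps ρ c₁ c₃

EnvStep : {α : Set} → Config α → Config α → Set₁
EnvStep c c' = proj₁ c' ≡ proj₁ c

-- Finite potential computations: a sequence c 0, …, c (n-1) with n ≥ 1
-- (entries of c at indices ≥ n are irrelevant).

StateRel : Set → Set₁
StateRel α = α → α → Set

StatePred : Set → Set₁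
StatePred α = α → Set

record Computation {α : Set} (ρ : CodeRet α) (p : Term α) : Set₁ where
  field
    len     : ℕ
    cfg     : ℕ → Config α
    nonempty : 0 < len
    start   : proj₁ (cfg 0) ≡ p
    trans   : ∀ i → suc i < len →
              Step ρ (cfg i) (cfg (suc i)) ⊎ EnvStep (cfg i) (cfg (suc i))

Valid : {α : Set} → CodeRet α → StateRel α → StatePred α → Term α →
        StatePred α → StateRel α → Set₁
Valid {α} ρ R P p Q G =
  (c : Computation ρ p) →
  let open Computation c in
  P (proj₂ (cfg 0)) →
  (∀ i → suc i < len → EnvStep (cfg i) (cfg (suc i)) →
         R (proj₂ (cfg i)) (proj₂ (cfg (suc i)))) →
  (∀ i → suc i < len → Step ρ (cfg i) (cfg (suc i)) →
         G (proj₂ (cfg i)) (proj₂ (cfg (suc i))))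
  × (∀ i → i < len → proj₁ (cfg i) ≡ skip →
         (∀ j → j < i → proj₁ (cfg j) ≢ skip) →
         Q (proj₂ (cfg i)))

IsSimulation : {α : Set} → CodeRet α → CodeRet α → StateRel α →
               (Term α → Term α → Set₁) → Set₁
IsSimulation ρ₁ ρ₂ r X =
  (∀ {p q σ₁ σ₂ q' σ₂'} → X p q → r σ₁ σ₂ → Step ρ₂ (q , σ₂) (q' , σ₂') →
     ∃ λ p' → ∃ λ σ₁' → Step ρ₁ (p , σ₁) (p' , σ₁') × X p' q' × r σ₁' σ₂')
  × (∀ {q} → X skip q → q ≡ skip)
  × (∀ {p} → X p skip → p ≡ skip)

Refines : {α : Set} → CodeRet α → CodeRet α → StateRel α →
          Term α → Term α → Set₂
Refines ρ₁ ρ₂ r p q =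
  ∃ λ (X : Term _ → Term _ → Set₁) → IsSimulation ρ₁ ρ₂ r X × X p q

record PState (A : Set) : Set where
  field
    flag₀ flag₁ turn turn-aux₀ turn-aux₁ : Bool
    shared local₀ local₁ : A
open PState public

module Peterson {A : Set} where

  S = PState A

  while′ : (S → Set) → Term S → Term S
  while′ C p = while C p skip

  thread₀ : Term S → Term S
  thread₀ cs₀ =
    basic (λ σ → record σ { flag₀ = true }) ⨾
    basic (λ σ → record σ { turn = true }) ⨾
    while′ (λ σ → T (flag₁ σ ∧ turn σ)) skip ⨾
    cs₀ ⨾
    basic (λ σ → record σ { flag₀ = false })

  thread₁ : Term S → Term S
  thread₁ cs₁ =
    basic (λ σ → record σ { flag₁ = true }) ⨾
    basic (λ σ → record σ { turn = false }) ⨾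
    while′ (λ σ → T (flag₀ σ ∧ not (turn σ))) skip ⨾
    cs₁ ⨾
    basic (λ σ → record σ { flag₁ = false })

  cond₀ : S → Set
  cond₀ σ = T (flag₀ σ ∧ (not (turn-aux₁ σ) ∨ not (flag₁ σ) ∨ not (turn σ)))

  cond₁ : S → Set
  cond₁ σ = T (flag₁ σ ∧ (not (turn-aux₀ σ) ∨ not (flag₀ σ) ∨ turn σ))

  r₀ : StateRel S
  r₀ σ σ' = σ ≡ σ' × T (turn-aux₀ σ) × cond₀ σ

  r₁ : StateRel S
  r₁ σ σ' = σ ≡ σ' × T (turn-aux₁ σ) × cond₁ σ

  r-eqv : StateRel S
  r-eqv σ σ' = flag₀ σ ≡ flag₀ σ' × flag₁ σ ≡ flag₁ σ' × turn σ ≡ turn σ'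
             × shared σ ≡ shared σ' × local₀ σ ≡ local₀ σ' × local₁ σ ≡ local₁ σ'

  G₀ : (A → Set) → (A → Set) → StateRel S
  G₀ P₁ Q₁ σ σ' = flag₀ σ ≡ flag₀ σ' × flag₁ σ ≡ flag₁ σ' × turn σ ≡ turn σ'
                × local₁ σ ≡ local₁ σ' × turn-aux₀ σ ≡ turn-aux₀ σ'
                × turn-aux₁ σ ≡ turn-aux₁ σ'
                × (P₁ (shared σ) → P₁ (shared σ')) × (Q₁ (shared σ) → Q₁ (shared σ'))

  G₁ : (A → Set) → (A → Set) → StateRel S
  G₁ P₀ Q₀ σ σ' = flag₀ σ ≡ flag₀ σ' × flag₁ σ ≡ flag₁ σ' × turn σ ≡ turn σ'
                × local₀ σ ≡ local₀ σ' × turn-aux₀ σ ≡ turn-aux₀ σ'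
                × turn-aux₁ σ ≡ turn-aux₁ σ'
                × (P₀ (shared σ) → P₀ (shared σ')) × (Q₀ (shared σ) → Q₀ (shared σ'))

  rely₀ : StateRel S
  rely₀ σ σ' = shared σ ≡ shared σ' × local₀ σ ≡ local₀ σ'

  rely₁ : StateRel S
  rely₁ σ σ' = shared σ ≡ shared σ' × local₁ σ ≡ local₁ σ'

  idRel : StateRel S
  idRel σ σ' = σ ≡ σ'

  topRel : StateRel S
  topRel _ _ = ⊤

open Peterson public

module Submission where

-- The rely of the parallel program is the identity and its guarantee is ⊤,
-- so the content is the postcondition: when thread₀ cs₀ ∥ thread₁ cs₁
-- terminates, Q₀ and Q₁ hold of the shared variable.  The proof is an
-- inductive invariant of configurations.  Each thread has a program counter
-- (Pos) and a local invariant (Local): its flag is up while it competes, its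
-- pre- resp. postcondition holds before resp. after its critical section,
-- Peterson's priority clause ties the turn to whoever yielded last, and
-- inside the critical section a trace records a run of its code, from a
-- state satisfying the precondition, under its rely.  The two priority
-- clauses give mutual exclusion; hence every step of one thread respects
-- the other's rely, traces remain runs, and validity of cs_i yields both the
-- postcondition and the guarantee G_i (which keeps the protocol variables
-- and the rival's pre- and postcondition).

open import Defs
open import Data.Bool using (Bool; true; false; _∧_; _∨_; not; T)
open import Data.Bool.Properties using (T-∨; not-injective; not-¬)
open import Data.Empty using (⊥; ⊥-elim)
open import Data.Fin using (zero; suc)
open import Data.Nat using (ℕ; zero; suc; _<_; z≤n; s≤s)
open import Data.Nat.Properties using (n<1+n; <-trans)
open import Data.Product using (Σ; _×_; _,_; proj₁; proj₂)
open import Data.Sum using (_⊎_; inj₁; inj₂)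
open import Data.Unit using (⊤; tt)
open import Data.Vec using (Vec; []; _∷_; lookup; _[_]≔_)
open import Data.Vec.Properties using (lookup∘update)
open import Data.Vec.Relation.Unary.All using ([]; _∷_)
open import Function using (_∘_; Equivalence)
open import Relation.Binary.Construct.Closure.ReflexiveTransitive using (Star; ε; _◅_; _◅◅_)
open import Relation.Binary.PropositionalEquality
open import Relation.Nullary using (¬_; Dec; yes; no)

skip? : ∀ {α} (p : Term α) → Dec (p ≡ skip)
skip? skip          = yes refl
skip? (basic _)     = no λ ()
skip? (cjump _ _ _) = no λ ()
skip? (while _ _ _) = no λ ()
skip? (if _ _ _)    = no λ ()
skip? (_ ⨾ _)       = no λ ()
skip? (par _ _)     = no λ ()
skip? (await _ _)   = no λ ()

module _ {α : Set} {ρ : CodeRet α} where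

  skip-is-final : ∀ {σ c} → ¬ Step ρ (skip , σ) c
  skip-is-final ()

  -- A program step that leaves the program unchanged (a stuttering cjump,
  -- possibly deep inside sequences and parallel compositions) leaves the
  -- state unchanged.  Environment-step clauses of a computation may match
  -- such a step, so the rely has to hold for it.
  stutter-fixes-state : ∀ {p p' σ σ'} → Step ρ (p , σ) (p' , σ') → p' ≡ p → σ' ≡ σ
  stutter-fixes-state (cjump-yes _)  _ = refl
  stutter-fixes-state (cjump-no _)   _ = refl
  stutter-fixes-state (if-yes _)     _ = refl
  stutter-fixes-state (if-no _)      _ = refl
  stutter-fixes-state (while-yes _)  _ = refl
  stutter-fixes-state (while-no _)   _ = refl
  stutter-fixes-state seq-skip       _ = refl
  stutter-fixes-state (seq-step s) refl = stutter-fixes-state s refl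
  stutter-fixes-state (par-step {ps = ps} i {p'} s) e =
    stutter-fixes-state s (begin
      p'                       ≡⟨ lookup∘update i ps p' ⟨
      lookup (ps [ i ]≔ p') i  ≡⟨ cong (λ qs → lookup qs i) (par-injective e) ⟩
      lookup ps i              ∎)
    where
    open ≡-Reasoning
    par-injective : ∀ {m} {xs ys : Vec (Term α) (suc m)} → par m xs ≡ par m ys → xs ≡ ys
    par-injective refl = refl

-- Environment steps are
-- only recorded while the program has not terminated, so in a run the first
-- configuration with program skip is the last one.
data Move {α : Set} (ρ : CodeRet α) (R : StateRel α) : Config α → Config α → Set₁ where
  prog : ∀ {c c'} → Step ρ c c' → Move ρ R c c'
  env  : ∀ {p σ σ'} → p ≢ skip → R σ σ' → Move ρ R (p , σ) (p , σ')

Run : {α : Set} → CodeRet α → StateRel α → Config α → Config α → Set₁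
Run ρ R = Star (Move ρ R)

_⊳_ : ∀ {α ρ R} {c₁ c₂ c₃ : Config α} → Run ρ R c₁ c₂ → Move ρ R c₂ c₃ → Run ρ R c₁ c₃
r ⊳ m = r ◅◅ (m ◅ ε)

module _ {α : Set} {ρ : CodeRet α} {R : StateRel α} where

  length : ∀ {c₁ c₂} → Run ρ R c₁ c₂ → ℕ
  length ε       = 0
  length (_ ◅ r) = suc (length r)

  -- The n-th configuration of a run (the last one for n ≥ length).
  config-at : ∀ {c₁ c₂} → Run ρ R c₁ c₂ → ℕ → Config α
  config-at {c₁} _ zero    = c₁
  config-at {c₂ = c₂} ε (suc _) = c₂
  config-at (_ ◅ r) (suc n) = config-at r n

  config-at-end : ∀ {c₁ c₂} (r : Run ρ R c₁ c₂) → config-at r (length r) ≡ c₂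
  config-at-end ε       = refl
  config-at-end (_ ◅ r) = config-at-end r

  move-at : ∀ {c₁ c₂} (r : Run ρ R c₁ c₂) n → suc n < suc (length r) →
            Move ρ R (config-at r n) (config-at r (suc n))
  move-at ε       zero    (s≤s ())
  move-at (m ◅ _) zero    _         = m
  move-at (_ ◅ r) (suc n) (s≤s n<l) = move-at r n n<l

  move-source-running : ∀ {p σ c} → Move ρ R (p , σ) c → p ≢ skip
  move-source-running (prog s)   refl = skip-is-final s
  move-source-running (env p≢ _) = p≢

  running-before-end : ∀ {c₁ c₂} (r : Run ρ R c₁ c₂) n → n < length r →
                       proj₁ (config-at r n) ≢ skip
  running-before-end (m ◅ _) zero    _         = move-source-running m
  running-before-end (_ ◅ r) (suc n) (s≤s n<l) = running-before-end r n n<l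

  length-⊳ : ∀ {c₁ c₂ c₃} (r : Run ρ R c₁ c₂) {m : Move ρ R c₂ c₃} →
             length (r ⊳ m) ≡ suc (length r)
  length-⊳ ε       = refl
  length-⊳ (_ ◅ r) = cong suc (length-⊳ r)

  config-at-⊳-old : ∀ {c₁ c₂ c₃} (r : Run ρ R c₁ c₂) {m : Move ρ R c₂ c₃} →
                    config-at (r ⊳ m) (length r) ≡ c₂
  config-at-⊳-old ε       = refl
  config-at-⊳-old (_ ◅ r) = config-at-⊳-old r

  config-at-⊳-new : ∀ {c₁ c₂ c₃} (r : Run ρ R c₁ c₂) {m : Move ρ R c₂ c₃} →
                    config-at (r ⊳ m) (suc (length r)) ≡ c₃
  config-at-⊳-new ε       = refl
  config-at-⊳-new (_ ◅ r) = config-at-⊳-new r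

  move-kind : ∀ {c c'} → Move ρ R c c' → Step ρ c c' ⊎ EnvStep c c'
  move-kind (prog s)  = inj₁ s
  move-kind (env _ _) = inj₂ refl

  computation : ∀ {p σ₀ c} → Run ρ R (p , σ₀) c → Computation ρ p
  computation r = record
    { len = suc (length r) ; cfg = config-at r ; nonempty = s≤s z≤n ; start = refl
    ; trans = λ n n<l → move-kind (move-at r n n<l) }

  module _ (R-refl : ∀ σ → R σ σ) where

    move-rely : ∀ {c c'} → Move ρ R c c' → EnvStep c c' → R (proj₂ c) (proj₂ c')
    move-rely (prog s) e = subst (R _) (sym (stutter-fixes-state s e)) (R-refl _)
    move-rely (env _ r) _ = r

    module _ {P Q : StatePred α} {G : StateRel α} {p : Term α}
             (valid : Valid ρ R P p Q G) {σ₀ : α} (pre : P σ₀) where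

      private
        rely-holds : ∀ {c} (r : Run ρ R (p , σ₀) c) n → suc n < suc (length r) →
                     EnvStep (config-at r n) (config-at r (suc n)) →
                     R (proj₂ (config-at r n)) (proj₂ (config-at r (suc n)))
        rely-holds r n n<l = move-rely (move-at r n n<l)

      valid-post : ∀ {σ} → Run ρ R (p , σ₀) (skip , σ) → Q σ
      valid-post r = subst (Q ∘ proj₂) (config-at-end r)
        (proj₂ (valid (computation r) pre (rely-holds r)) (length r) (n<1+n _)
          (cong proj₁ (config-at-end r)) (running-before-end r))

      valid-guarantee : ∀ {c c'} → Run ρ R (p , σ₀) c → Step ρ c c' → G (proj₂ c) (proj₂ c')
      valid-guarantee {c' = c'} r s =
        subst₂ (λ a b → G (proj₂ a) (proj₂ b)) (config-at-⊳-old r) (config-at-⊳-new r)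
          (proj₁ (valid (computation r') pre (rely-holds r')) (length r) last-index
            (subst₂ (Step ρ) (sym (config-at-⊳-old r)) (sym (config-at-⊳-new r)) s))
        where
        r' : Run ρ R (p , σ₀) c'
        r' = r ⊳ prog s
        last-index : suc (length r) < suc (length r')
        last-index rewrite length-⊳ r {prog s} = n<1+n _

module _ {α : Set} {ρ : CodeRet α} {p : Term α} (c : Computation ρ p) where
  open Computation c renaming (trans to transition)

  invariant-along : (I : Config α → Set₁) → I (cfg 0) →
    (∀ {c c'} → I c → Step ρ c c' → I c') →
    (∀ n → suc n < len → EnvStep (cfg n) (cfg (suc n)) → I (cfg n) → I (cfg (suc n))) →
    ∀ n → n < len → I (cfg n)
  invariant-along I init prog-step env-step = holds
    where
    holds : ∀ n → n < len → I (cfg n)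
    holds zero    _       = init
    holds (suc n) n+1<len = extend (transition n n+1<len) (holds n (<-trans (n<1+n n) n+1<len))
      where
      extend : Step ρ (cfg n) (cfg (suc n)) ⊎ EnvStep (cfg n) (cfg (suc n)) →
               I (cfg n) → I (cfg (suc n))
      extend (inj₁ s) = λ here → prog-step here s
      extend (inj₂ e) = env-step n n+1<len e

data Thread : Set where
  t₀ t₁ : Thread

other : Thread → Thread
other t₀ = t₁
other t₁ = t₀

select : ∀ {a} {X : Set a} → Thread → X → X → X
select t₀ x _ = x
select t₁ _ y = y

-- Boolean equality, by cases on the first argument so that `equals true b`
-- is b and `equals false b` is not b.
equals : Bool → Bool → Bool
equals true  b = b
equals false b = not b

released : ∀ f v t → ¬ T (f ∧ equals v t) → T f → t ≡ not v
released true true  false _       _ = refl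
released true true  true  stuck _ = ⊥-elim (stuck tt)
released true false false stuck _ = ⊥-elim (stuck tt)
released true false true  _       _ = refl

widen : ∀ a {b} → T b → T (a ∨ b)
widen _ x = Equivalence.from T-∨ (inj₂ x)

-- The value thread i writes to `turn` to give priority to its rival.
yield : Thread → Bool
yield i = select i true false

yield-other : ∀ i → yield i ≡ not (yield (other i))
yield-other t₀ = refl
yield-other t₁ = refl

module _ {A : Set} where
  private
    State = PState A

  flag : Thread → State → Bool
  flag i σ = select i (flag₀ σ) (flag₁ σ)

  local : Thread → State → A
  local i σ = select i (local₀ σ) (local₁ σ)

  -- Only the flag of thread i changes; written field-wise so that every
  -- other field of setFlag i b σ is definitionally that of σ.
  setFlag : Thread → Bool → State → State
  setFlag i b σ = record σ { flag₀ = select i b (flag₀ σ) ; flag₁ = select i (flag₁ σ) b }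

  flag-setFlag : ∀ i b σ → flag i (setFlag i b σ) ≡ b
  flag-setFlag t₀ _ _ = refl
  flag-setFlag t₁ _ _ = refl

  rival-flag-setFlag : ∀ i b σ → flag (other i) σ ≡ flag (other i) (setFlag i b σ)
  rival-flag-setFlag t₀ _ _ = refl
  rival-flag-setFlag t₁ _ _ = refl

  blocked : Thread → State → Set
  blocked i σ = T (flag (other i) σ ∧ equals (yield i) (turn σ))

  raise lower yield-turn spin : Thread → Term State
  raise i      = basic (setFlag i true)
  yield-turn i = basic (λ σ → record σ { turn = yield i })
  spin i       = while (blocked i) skip skip
  lower i      = basic (setFlag i false)

  -- Thread i raises its flag, yields the turn by writing `yield i`, spins
  -- while the rival's flag is up and the turn still holds its own yield
  -- value, runs its critical section and lowers its flag.  thread t₀ and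
  -- thread t₁ are definitionally thread₀ and thread₁.
  thread : Thread → Term State → Term State
  thread i cs = raise i ⨾ yield-turn i ⨾ spin i ⨾ cs ⨾ lower i

  rely : Thread → StateRel State
  rely i σ σ' = shared σ ≡ shared σ' × local i σ ≡ local i σ'

  rely-refl : ∀ i σ → rely i σ σ
  rely-refl _ _ = refl , refl

module Correctness {A : Set} (P₀ Q₀ P₁ Q₁ : A → Set) (ρ : CodeRet (PState A))
  (cs₀ cs₁ : Term (PState A))
  (V₀ : Valid ρ rely₀ (λ σ → P₀ (shared σ)) cs₀ (λ σ → Q₀ (shared σ)) (G₀ P₁ Q₁))
  (V₁ : Valid ρ rely₁ (λ σ → P₁ (shared σ)) cs₁ (λ σ → Q₁ (shared σ)) (G₁ P₀ Q₀)) where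

  private
    State = PState A

  code : Thread → Term State
  code i = select i cs₀ cs₁

  pre post : Thread → A → Set
  pre i  = select i P₀ P₁
  post i = select i Q₀ Q₁

  guar : Thread → StateRel State
  guar i = select i (G₀ P₁ Q₁) (G₁ P₀ Q₀)

  valid : ∀ i → Valid ρ (rely i) (pre i ∘ shared) (code i) (post i ∘ shared) (guar i)
  valid t₀ = V₀
  valid t₁ = V₁

  finishes : ∀ i {σ₀ σ} → pre i (shared σ₀) → Run ρ (rely i) (code i , σ₀) (skip , σ) →
             post i (shared σ)
  finishes i P = valid-post (rely-refl i) {pre i ∘ shared} {post i ∘ shared} {guar i} (valid i) P

  respects : ∀ i {σ₀ c c'} → pre i (shared σ₀) → Run ρ (rely i) (code i , σ₀) c →
             Step ρ c c' → guar i (proj₂ c) (proj₂ c')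
  respects i P =
    valid-guarantee (rely-refl i) {pre i ∘ shared} {post i ∘ shared} {guar i} (valid i) P

  record Harmless (j : Thread) (σ σ' : State) : Set where
    field
      flag-kept : flag j σ ≡ flag j σ'
      pre-kept  : pre j (shared σ) → pre j (shared σ')
      post-kept : post j (shared σ) → post j (shared σ')
  open Harmless

  protocol-harmless : ∀ {j σ σ'} → flag j σ ≡ flag j σ' → shared σ ≡ shared σ' → Harmless j σ σ'
  protocol-harmless {j} same-flag same-shared = record
    { flag-kept = same-flag
    ; pre-kept  = subst (pre j) same-shared
    ; post-kept = subst (post j) same-shared }

  guarantee-effects : ∀ i {σ σ'} → guar i σ σ' →
                      Harmless (other i) σ σ' × flag i σ ≡ flag i σ' × turn σ ≡ turn σ'
  guarantee-effects t₀ (f₀ , f₁ , t , _ , _ , _ , p₁ , q₁) =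
    record { flag-kept = f₁ ; pre-kept = p₁ ; post-kept = q₁ } , f₀ , t
  guarantee-effects t₁ (f₀ , f₁ , t , _ , _ , _ , p₀ , q₀) =
    record { flag-kept = f₀ ; pre-kept = p₀ ; post-kept = q₀ } , f₁ , t

  -- Program counter of thread i: the shapes its term takes while running
  -- thread i (code i).  `critical` covers any residual c of the critical
  -- section; the invariant only admits it while c has not terminated.
  data Pos (i : Thread) : Term State → Set₁ where
    idle      : Pos i (thread i (code i))
    raised    : Pos i (skip ⨾ yield-turn i ⨾ spin i ⨾ code i ⨾ lower i)
    ready     : Pos i (yield-turn i ⨾ spin i ⨾ code i ⨾ lower i)
    yielded   : Pos i (skip ⨾ spin i ⨾ code i ⨾ lower i)
    spinning  : Pos i (spin i ⨾ code i ⨾ lower i)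
    unrolled  : Pos i ((skip ⨾ skip ⨾ spin i) ⨾ code i ⨾ lower i)
    unrolled′ : Pos i ((skip ⨾ spin i) ⨾ code i ⨾ lower i)
    entering  : Pos i (skip ⨾ code i ⨾ lower i)
    critical  : ∀ {c} → Pos i (c ⨾ lower i)
    exiting   : Pos i (skip ⨾ lower i)
    lowering  : Pos i (lower i)
    finished  : Pos i skip

  -- Classification of positions.  The derived classes are disjunctions, so
  -- that inclusions between them come for free (`widen`).
  inCS atGate waiting flagOnly beforeCS afterCS : ∀ {i t} → Pos i t → Bool
  inCS critical = true
  inCS _        = false
  atGate entering = true
  atGate exiting  = true
  atGate _        = false
  waiting yielded   = true
  waiting spinning  = true
  waiting unrolled  = true
  waiting unrolled′ = true
  waiting _         = false
  flagOnly raised   = true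
  flagOnly ready    = true
  flagOnly lowering = true
  flagOnly _        = false
  beforeCS critical = false
  beforeCS exiting  = false
  beforeCS lowering = false
  beforeCS finished = false
  beforeCS _        = true
  afterCS exiting  = true
  afterCS lowering = true
  afterCS finished = true
  afterCS _        = false

  admitted hasYielded flagUp : ∀ {i t} → Pos i t → Bool
  admitted p   = atGate p ∨ inCS p
  hasYielded p = waiting p ∨ admitted p
  flagUp p     = flagOnly p ∨ hasYielded p

  residual : Term State → Term State
  residual (c ⨾ _) = c
  residual _       = skip

  Trace : Thread → Term State → State → Set₁
  Trace i c σ =
    c ≢ skip × Σ State λ σ₀ → pre i (shared σ₀) × Run ρ (rely i) (code i , σ₀) (c , σ)

  -- The invariant of thread i at position p in state σ; Rival says that the
  -- other thread has yielded.  The priority clause is Peterson's key fact: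
  -- once i is admitted while its rival has yielded, the rival wrote the
  -- turn last, so the turn no longer holds i's own yield value.
  record Local (i : Thread) {t} (p : Pos i t) (Rival : Set) (σ : State) : Set₁ where
    field
      flag-up    : T (flagUp p) → T (flag i σ)
      priority   : T (admitted p) → Rival → turn σ ≡ not (yield i)
      pre-holds  : T (beforeCS p) → pre i (shared σ)
      post-holds : T (afterCS p) → post i (shared σ)
      history    : T (inCS p) → Trace i (residual t) σ
  open Local

  -- How thread j's invariant survives a step σ → σ' of its rival: the step
  -- must be harmless to j, re-establish j's priority clause (the rival's
  -- yield status may change from Rival to Rival'), and respect j's rely while
  -- j is in its critical section, so that j's trace records it as an
  -- environment step.
  observe : ∀ {j t} (q : Pos j t) {Rival Rival' σ σ'} → Local j q Rival σ → Harmless j σ σ' →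
            (T (admitted q) → Rival' → turn σ' ≡ not (yield j)) →
            (T (inCS q) → rely j σ σ') → Local j q Rival' σ'
  observe {j} {t} q {σ = σ} {σ'} inv harmless prio respects-rely = record
    { flag-up    = subst T (flag-kept harmless) ∘ flag-up inv
    ; priority   = prio
    ; pre-holds  = pre-kept harmless ∘ pre-holds inv
    ; post-holds = post-kept harmless ∘ post-holds inv
    ; history    = λ in-cs → extend (history inv in-cs) (respects-rely in-cs) }
    where
    extend : Trace j (residual t) σ → rely j σ σ' → Trace j (residual t) σ'
    extend (unfinished , σ₀ , P , run) r = unfinished , σ₀ , P , run ⊳ env unfinished r

  -- Mutual exclusion: the two threads are never admitted at the same time,
  -- since each priority clause would force the turn away from its own
  -- thread's yield value, and the two yield values differ.
  exclusive : ∀ {i u v σ} (p : Pos i u) (q : Pos (other i) v) →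
              Local i p (T (hasYielded q)) σ → Local (other i) q (T (hasYielded p)) σ →
              T (admitted p) → T (admitted q) → ⊥
  exclusive {i} p q mine theirs p-in q-in = not-¬ (not-injective turns-agree) (yield-other i)
    where
    turns-agree : not (yield i) ≡ not (yield (other i))
    turns-agree = trans (sym (priority mine p-in (widen (waiting q) q-in)))
                        (priority theirs q-in (widen (waiting p) p-in))

  record Moved (i : Thread) {v} (q : Pos (other i) v) (u' : Term State) (σ' : State) : Set₁ where
    constructor moved
    field
      position : Pos i u'
      mine     : Local i position (T (hasYielded q)) σ'
      theirs   : Local (other i) q (T (hasYielded position)) σ'

  settle : ∀ i {v c σ₀ σ} (q : Pos (other i) v) → pre i (shared σ₀) →
           Run ρ (rely i) (code i , σ₀) (c , σ) → T (flag i σ) →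
           (T (hasYielded q) → turn σ ≡ not (yield i)) → Local (other i) q ⊤ σ →
           Moved i q (c ⨾ lower i) σ
  settle i {c = c} q P run up prio theirs with skip? c
  ... | yes refl = moved exiting (record
    { flag-up = λ _ → up ; priority = λ _ → prio ; pre-holds = λ ()
    ; post-holds = λ _ → finishes i P run ; history = λ () }) theirs
  ... | no unfinished = moved critical (record
    { flag-up = λ _ → up ; priority = λ _ → prio ; pre-holds = λ () ; post-holds = λ ()
    ; history = λ _ → unfinished , _ , P , run }) theirs

  -- A step inside the critical section respects the guarantee of thread i
  -- (validity of code i), hence keeps the protocol variables and is
  -- harmless to the rival, which by mutual exclusion is not admitted.
  critical-step : ∀ i {c v c' σ σ'} (q : Pos (other i) v) →
                  Local i (critical {c = c}) (T (hasYielded q)) σ → Local (other i) q ⊤ σ →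
                  Step ρ (c , σ) (c' , σ') → Moved i q (c' ⨾ lower i) σ'
  critical-step i {σ = σ} {σ'} q mine theirs s with history mine tt
  ... | _ , _ , P , run =
    settle i q P (run ⊳ prog s) (subst T same-flag (flag-up mine tt))
      (λ rival-yielded → trans (sym same-turn) (priority mine tt rival-yielded))
      (observe q theirs harmless (λ q-in → ⊥-elim (rival-out q-in))
                                 (λ q-cs → ⊥-elim (rival-out (widen (atGate q) q-cs))))
    where
    effects : Harmless (other i) σ σ' × flag i σ ≡ flag i σ' × turn σ ≡ turn σ'
    effects = guarantee-effects i (respects i P run s)
    harmless = proj₁ effects
    same-flag = proj₁ (proj₂ effects)
    same-turn = proj₂ (proj₂ effects)
    rival-out : ¬ T (admitted q)
    rival-out = exclusive critical q mine theirs tt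

  -- Protocol steps change
  -- only flag i or the turn (harmless to the rival); leaving the spin loop
  -- establishes the priority clause; critical-section steps are handled by
  -- `settle` and `critical-step`.
  advance : ∀ i {u v u' σ σ'} (p : Pos i u) (q : Pos (other i) v) →
            Local i p (T (hasYielded q)) σ → Local (other i) q (T (hasYielded p)) σ →
            Step ρ (u , σ) (u' , σ') → Moved i q u' σ'
  advance i idle q mine theirs (seq-step (basic-step _ σ)) = moved raised
    (record { flag-up = λ _ → subst T (sym (flag-setFlag i true σ)) tt ; priority = λ ()
            ; pre-holds = pre-holds mine ; post-holds = λ () ; history = λ () })
    (observe q theirs (protocol-harmless (rival-flag-setFlag i true σ) refl) (λ _ ())
                      (λ _ → rely-refl (other i) σ))
  advance i raised q mine theirs seq-skip = moved ready
    (record { flag-up = flag-up mine ; priority = λ () ; pre-holds = pre-holds mine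
            ; post-holds = λ () ; history = λ () })
    theirs
  advance i ready q mine theirs (seq-step (basic-step _ σ)) = moved yielded
    (record { flag-up = flag-up mine ; priority = λ () ; pre-holds = pre-holds mine
            ; post-holds = λ () ; history = λ () })
    (observe q theirs (protocol-harmless refl refl) (λ _ _ → yield-other i)
                      (λ _ → rely-refl (other i) σ))
  advance i yielded q mine theirs seq-skip = moved spinning
    (record { flag-up = flag-up mine ; priority = λ () ; pre-holds = pre-holds mine
            ; post-holds = λ () ; history = λ () })
    theirs
  advance i spinning q mine theirs (seq-step (while-yes _)) = moved unrolled
    (record { flag-up = flag-up mine ; priority = λ () ; pre-holds = pre-holds mine
            ; post-holds = λ () ; history = λ () })
    theirs
  advance i {σ = σ} spinning q mine theirs (seq-step (while-no unblocked)) = moved entering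
    (record { flag-up = flag-up mine ; pre-holds = pre-holds mine
            ; post-holds = λ () ; history = λ ()
            ; priority = λ _ rival-yielded →
                released (flag (other i) σ) (yield i) (turn σ) unblocked
                         (flag-up theirs (widen (flagOnly q) rival-yielded)) })
    theirs
  advance i unrolled  q mine theirs (seq-step seq-skip) = moved unrolled′
    (record { flag-up = flag-up mine ; priority = λ () ; pre-holds = pre-holds mine
            ; post-holds = λ () ; history = λ () })
    theirs
  advance i unrolled′ q mine theirs (seq-step seq-skip) = moved spinning
    (record { flag-up = flag-up mine ; priority = λ () ; pre-holds = pre-holds mine
            ; post-holds = λ () ; history = λ () })
    theirs
  advance i entering q mine theirs seq-skip =
    settle i q (pre-holds mine tt) ε (flag-up mine tt) (priority mine tt) theirs
  advance i critical q mine theirs seq-skip = ⊥-elim (proj₁ (history mine tt) refl)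
  advance i critical q mine theirs (seq-step s) = critical-step i q mine theirs s
  advance i {σ = σ} exiting q mine theirs seq-skip = moved lowering
    (record { flag-up = flag-up mine ; priority = λ () ; pre-holds = λ ()
            ; post-holds = post-holds mine ; history = λ () })
    (observe q theirs (protocol-harmless refl refl) (λ _ ()) (λ _ → rely-refl (other i) σ))
  advance i lowering q mine theirs (basic-step _ σ) = moved finished
    (record { flag-up = λ () ; priority = λ () ; pre-holds = λ ()
            ; post-holds = post-holds mine ; history = λ () })
    (observe q theirs (protocol-harmless (rival-flag-setFlag i false σ) refl) (λ _ ())
                      (λ _ → rely-refl (other i) σ))

  data Inv : Config State → Set₁ where
    executing  : ∀ {u v σ} (p : Pos t₀ u) (q : Pos t₁ v) →
                 Local t₀ p (T (hasYielded q)) σ → Local t₁ q (T (hasYielded p)) σ →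
                 Inv (par 1 (u ∷ v ∷ []) , σ)
    terminated : ∀ {σ} → Q₀ (shared σ) → Q₁ (shared σ) → Inv (skip , σ)

  initially : ∀ {σ} → P₀ (shared σ) → P₁ (shared σ) → Inv (thread₀ cs₀ ∥ thread₁ cs₁ , σ)
  initially p₀ p₁ = executing idle idle (start p₀) (start p₁)
    where
    start : ∀ {i σ} → pre i (shared σ) → Local i idle ⊥ σ
    start P = record { flag-up = λ () ; priority = λ () ; pre-holds = λ _ → P
                     ; post-holds = λ () ; history = λ () }

  preserved : ∀ {c c'} → Inv c → Step ρ c c' → Inv c'
  preserved (executing p q mine theirs) (par-step zero s) =
    let moved p' mine' theirs' = advance t₀ p q mine theirs s in executing p' q mine' theirs'
  preserved (executing p q mine theirs) (par-step (suc zero) s) =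
    let moved q' mine' theirs' = advance t₁ q p theirs mine s in executing p q' theirs' mine'
  preserved (executing p q mine theirs) (par-skip (refl ∷ refl ∷ [])) = join p q mine theirs
    where
    join : ∀ {σ} (p : Pos t₀ skip) (q : Pos t₁ skip) →
           Local t₀ p (T (hasYielded q)) σ → Local t₁ q (T (hasYielded p)) σ → Inv (skip , σ)
    join finished finished mine theirs = terminated (post-holds mine tt) (post-holds theirs tt)

  postcondition : ∀ {c} → Inv c → proj₁ c ≡ skip →
                  Q₀ (shared (proj₂ c)) × Q₁ (shared (proj₂ c))
  postcondition (executing _ _ _ _) ()
  postcondition (terminated q₀ q₁) _ = q₀ , q₁

-- For the postcondition, the invariant holds
-- along every computation: initially by the preconditions, across program
-- steps by `preserved`, and across environment steps because the rely is
-- the identity.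
mainTheorem17 : {A : Set} (P₀ Q₀ P₁ Q₁ : A → Set) (ρ : CodeRet (PState A))
    (cs₀ cs₁ : Term (PState A)) →
    Valid ρ rely₀ (λ σ → P₀ (shared σ)) cs₀ (λ σ → Q₀ (shared σ)) (G₀ P₁ Q₁) →
    Valid ρ rely₁ (λ σ → P₁ (shared σ)) cs₁ (λ σ → Q₁ (shared σ)) (G₁ P₀ Q₀) →
    Refines ρ ρ r₀ cs₀ cs₀ →
    Refines ρ ρ r₁ cs₁ cs₁ →
    Refines ρ ρ r-eqv cs₀ cs₀ →
    Refines ρ ρ r-eqv cs₁ cs₁ →
    Valid ρ idRel (λ σ → P₀ (shared σ) × P₁ (shared σ))
      (thread₀ cs₀ ∥ thread₁ cs₁)
      (λ σ → Q₀ (shared σ) × Q₁ (shared σ)) topRel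
mainTheorem17 P₀ Q₀ P₁ Q₁ ρ cs₀ cs₁ V₀ V₁ _ _ _ _ comp (p₀ , p₁) env-is-identity =
  (λ _ _ _ → tt) , λ n n<len is-skip _ → postcondition (invariant n n<len) is-skip
  where
  open Correctness P₀ Q₀ P₁ Q₁ ρ cs₀ cs₁ V₀ V₁
  open Computation comp
  invariant : ∀ n → n < len → Inv (cfg n)
  invariant = invariant-along comp Inv
    (subst (λ t → Inv (t , proj₂ (cfg 0))) (sym start) (initially p₀ p₁))
    preserved
    (λ n n+1<len e → subst₂ (λ t σ → Inv (t , σ)) (sym e) (env-is-identity n n+1<len e))
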